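{- Consider an instance of Nemesis with graph $G=(V,E)$, a set of exits, and a starting vertex $s$. If $s$ or one of its neighbors in $G$ is the root of a binary escape tree of $G$, then the fugitive has a winning strategy.
   Context: Nemesis is a two-player game. An instance consists of a finite graph $G=(V,E)$, a set of vertices called exits, and a starting vertex $s$ for the first player, the fugitive. In each round the fugitive first moves from his current vertex to an adjacent vertex along an edge still present; then the second player, the Nemesis, permanently removes exactly one edge chosen anywhere in the current graph. The fugitive wins if he reaches an exit; the Nemesis wins if the fugitive ends up in a connected component of the current graph containing no exit. A binary escape tree of $G$ is a rooted full binary tree (every internal node has exactly two children) whose vertices and edges belong to $G$ and all of whose leaves are exits. -}

module Defs where

open import Data.Nat using (ℕ)
open import Data.Fin using (Fin; _≟_)
open import Data.Fin.Subset using (Subset; _∈_)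
open import Data.Bool using (Bool; true; false; if_then_else_; _∧_; _∨_)
open import Data.List using (List; []; _∷_; _++_)
open import Data.List.Relation.Unary.Unique.Propositional using (Unique)
open import Data.Product using (_×_; Σ; ∃; _,_)
open import Relation.Nullary.Decidable using (⌊_⌋)
open import Relation.Binary.PropositionalEquality using (_≡_)

-- A finite (simple) graph on the vertex set Fin n, given by a Boolean
-- adjacency relation.  The current graph during the game is again such a
-- relation (a subgraph of the original one).
Graph : ℕ → Set
Graph n = Fin n → Fin n → Bool

IsSimpleGraph : ∀ {n} → Graph n → Set
IsSimpleGraph {n} G =
  ((u v : Fin n) → G u v ≡ G v u) × ((u : Fin n) → G u u ≡ false)

Edge : ∀ {n} → Graph n → Fin n → Fin n → Set
Edge G u v = G u v ≡ true

removeEdge : ∀ {n} → Graph n → Fin n → Fin n → Graph n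
removeEdge E a b x y =
  if (⌊ x ≟ a ⌋ ∧ ⌊ y ≟ b ⌋) ∨ (⌊ x ≟ b ⌋ ∧ ⌊ y ≟ a ⌋)
  then false else E x y

-- FugitiveWins X E v : the fugitive, standing on v in the current graph E
-- and about to move, has a winning strategy (exits X).  The game is finite
-- (each round removes an edge), so winning positions are defined inductively.
data FugitiveWins {n : ℕ} (X : Subset n) : Graph n → Fin n → Set where
  atExit  : ∀ {E v} → v ∈ X → FugitiveWins X E v
  toExit  : ∀ {E v} (w : Fin n) → Edge E v w → w ∈ X → FugitiveWins X E v
  -- move along an edge to w; the Nemesis must be able to remove an edge
  -- (otherwise w is isolated and not an exit, so the Nemesis has won), and
  -- whichever edge {a,b} the Nemesis removes, the fugitive still wins.
  step    : ∀ {E v} (w : Fin n) → Edge E v w →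
            (∃ λ a → ∃ λ b → Edge E a b) →
            ((a b : Fin n) → Edge E a b → FugitiveWins X (removeEdge E a b) w) →
            FugitiveWins X E v

data BTree (n : ℕ) : Set where
  leaf : Fin n → BTree n
  node : Fin n → BTree n → BTree n → BTree n

root : ∀ {n} → BTree n → Fin n
root (leaf v)     = v
root (node v _ _) = v

vertices : ∀ {n} → BTree n → List (Fin n)
vertices (leaf v)     = v ∷ []
vertices (node v l r) = v ∷ (vertices l ++ vertices r)

data EscapeShape {n : ℕ} (G : Graph n) (X : Subset n) : BTree n → Set where
  leafOK : ∀ {v} → v ∈ X → EscapeShape G X (leaf v)
  nodeOK : ∀ {v l r} → Edge G v (root l) → Edge G v (root r) →
           EscapeShape G X l → EscapeShape G X r →
           EscapeShape G X (node v l r)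

-- A binary escape tree of G: a rooted full binary tree that is a subgraph
-- of G (tree vertices are pairwise distinct vertices of G, tree edges are
-- edges of G) and all of whose leaves are exits.
IsBinaryEscapeTree : ∀ {n} → Graph n → Subset n → BTree n → Set
IsBinaryEscapeTree G X t = EscapeShape G X t × Unique (vertices t)

-- The fugitive walks down the escape tree, always standing on a vertex u from
-- which two vertex-disjoint escape subtrees hang.  Whatever edge {a,b} the
-- Nemesis deletes, one endpoint c differs from u (the graph is loopless), and c
-- misses u together with one of the two subtrees.  That subtree and its edge to u
-- avoid c, so they survive intact and the fugitive steps to its root; at a leaf
-- he steps onto an exit.  Starting at the root itself, he first steps to a child.
{-# OPTIONS --safe #-}
module Submission where

open import Defs
open import Function using (_∘_)
open import Data.Nat using (ℕ)
open import Data.Fin using (Fin; _≟_)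
open import Data.Fin.Subset using (Subset)
open import Data.Bool using (true; false; _∧_; _∨_)
open import Data.Bool.Properties using (∧-zeroʳ)
open import Data.Product using (Σ; ∃; _×_; _,_; proj₁)
open import Data.Sum using (_⊎_; inj₁; inj₂)
open import Data.List using (List; []; _∷_; _++_)
open import Data.List.Relation.Unary.Any using (here; there; any?)
import Data.List.Relation.Unary.All as All
open import Data.List.Relation.Unary.All.Properties using (++⁻ˡ)
open import Data.List.Relation.Unary.AllPairs using ([]; _∷_)
open import Data.List.Relation.Unary.Unique.Propositional using (Unique)
open import Data.List.Relation.Binary.Disjoint.Propositional using (Disjoint)
open import Data.List.Relation.Binary.Subset.Propositional.Properties using (∷⁺ʳ; xs⊆xs++ys; xs⊆ys++xs)
open import Data.List.Membership.Propositional using (_∈_; _∉_)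
open import Data.List.Membership.Propositional.Properties using (∈-++⁺ʳ)
open import Relation.Nullary using (yes; no; contradiction)
open import Relation.Nullary.Decidable using (⌊_⌋)
open import Relation.Binary.PropositionalEquality using (_≡_; _≢_; refl; sym; trans)

Unique-++⁻ : ∀ {A : Set} (xs : List A) {ys : List A} →
             Unique (xs ++ ys) → Unique xs × Unique ys × Disjoint xs ys
Unique-++⁻ []       u = [] , u , λ { (() , _) }
Unique-++⁻ (x ∷ xs) {ys} (x∉xs++ys ∷ u) with Unique-++⁻ xs u
... | uxs , uys , disjoint = ++⁻ˡ xs x∉xs++ys ∷ uxs , uys , disjoint′
  where
  disjoint′ : Disjoint (x ∷ xs) ys
  disjoint′ (here refl  , v∈ys) = All.lookup x∉xs++ys (∈-++⁺ʳ xs v∈ys) refl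
  disjoint′ (there v∈xs , v∈ys) = disjoint (v∈xs , v∈ys)

∉-∷⁺ : ∀ {A : Set} {c u : A} {xs : List A} → c ≢ u → c ∉ xs → c ∉ u ∷ xs
∉-∷⁺ c≢u c∉xs (here c≡u)  = c≢u c≡u
∉-∷⁺ c≢u c∉xs (there c∈xs) = c∉xs c∈xs

∈-∉⇒≢ : ∀ {A : Set} {x c : A} {xs : List A} → x ∈ xs → c ∉ xs → x ≢ c
∈-∉⇒≢ x∈xs c∉xs refl = c∉xs x∈xs

module _ {n : ℕ} where

  Loopless : Graph n → Set
  Loopless E = (x : Fin n) → E x x ≡ false

  Endpoint : Fin n → Fin n → Fin n → Set
  Endpoint a b c = c ≡ a ⊎ c ≡ b

  loopless⇒≢ : ∀ {E a b} → Loopless E → Edge E a b → a ≢ b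
  loopless⇒≢ loopless e refl with trans (sym e) (loopless _)
  ... | ()

  removeEdge-loopless : ∀ {E} a b → Loopless E → Loopless (removeEdge E a b)
  removeEdge-loopless a b loopless x with (⌊ x ≟ a ⌋ ∧ ⌊ x ≟ b ⌋) ∨ (⌊ x ≟ b ⌋ ∧ ⌊ x ≟ a ⌋)
  ... | true  = refl
  ... | false = loopless x

  removeEdge-avoiding : ∀ {E a b c x y} → Endpoint a b c → x ≢ c → y ≢ c →
                        removeEdge E a b x y ≡ E x y
  removeEdge-avoiding {a = a} {b} {x = x} {y} (inj₁ refl) x≢a y≢a
    with x ≟ a | y ≟ a
  ... | yes x≡a | _       = contradiction x≡a x≢a
  ... | no _    | yes y≡a = contradiction y≡a y≢a
  ... | no _    | no _    rewrite ∧-zeroʳ ⌊ x ≟ b ⌋ = refl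
  removeEdge-avoiding {a = a} {b} {x = x} {y} (inj₂ refl) x≢b y≢b
    with x ≟ b | y ≟ b
  ... | yes x≡b | _       = contradiction x≡b x≢b
  ... | no _    | yes y≡b = contradiction y≡b y≢b
  ... | no _    | no _    rewrite ∧-zeroʳ ⌊ x ≟ a ⌋ = refl

  Planted : Graph n → Subset n → Fin n → BTree n → Set
  Planted E X v t = Edge E v (root t) × EscapeShape E X t

  root∈vertices : (t : BTree n) → root t ∈ vertices t
  root∈vertices (leaf v)     = here refl
  root∈vertices (node v _ _) = here refl

  mutual
    escapeShape-removeEdge : ∀ {E X a b c} (t : BTree n) → Endpoint a b c → c ∉ vertices t →
                             EscapeShape E X t → EscapeShape (removeEdge E a b) X t
    escapeShape-removeEdge (leaf v) _ _ (leafOK v∈X) = leafOK v∈X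
    escapeShape-removeEdge (node v l r) c∈ab c∉t (nodeOK el er sl sr)
      with planted-removeEdge l c∈ab (c∉t ∘ ∷⁺ʳ v (xs⊆xs++ys (vertices l) (vertices r))) (el , sl)
         | planted-removeEdge r c∈ab (c∉t ∘ ∷⁺ʳ v (xs⊆ys++xs (vertices r) (vertices l))) (er , sr)
    ... | el′ , sl′ | er′ , sr′ = nodeOK el′ er′ sl′ sr′

    planted-removeEdge : ∀ {E X a b c v} (t : BTree n) → Endpoint a b c → c ∉ v ∷ vertices t →
                         Planted E X v t → Planted (removeEdge E a b) X v t
    planted-removeEdge {E} t c∈ab c∉vt (e , shape) =
      trans (removeEdge-avoiding {E} c∈ab (∈-∉⇒≢ (here refl) c∉vt)
                                          (∈-∉⇒≢ (there (root∈vertices t)) c∉vt)) e ,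
      escapeShape-removeEdge t c∈ab (c∉vt ∘ there) shape

  endpoint-≢ : ∀ {a b} → a ≢ b → (u : Fin n) → ∃ λ c → Endpoint a b c × c ≢ u
  endpoint-≢ {a} {b} a≢b u with a ≟ u
  ... | yes refl = b , inj₂ refl , a≢b ∘ sym
  ... | no a≢u   = a , inj₁ refl , a≢u

  ∉-one-branch : ∀ {c u} {ls rs : List (Fin n)} → Disjoint ls rs → c ≢ u →
                 c ∉ u ∷ ls ⊎ c ∉ u ∷ rs
  ∉-one-branch {c} {ls = ls} disjoint c≢u with any? (c ≟_) ls
  ... | yes c∈ls = inj₂ (∉-∷⁺ c≢u λ c∈rs → disjoint (c∈ls , c∈rs))
  ... | no  c∉ls = inj₁ (∉-∷⁺ c≢u c∉ls)

  unique-children : ∀ {u} {l r : BTree n} → Unique (vertices (node u l r)) →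
                    Unique (vertices l) × Unique (vertices r) × Disjoint (vertices l) (vertices r)
  unique-children {l = l} (_ ∷ unique) = Unique-++⁻ (vertices l) unique

  planted-wins : ∀ {X E v} (t : BTree n) → Loopless E → Unique (vertices t) →
                 Planted E X v t → FugitiveWins X E v
  planted-wins (leaf u) _ _ (e , leafOK u∈X) = toExit u e u∈X
  planted-wins {X} {E} {v} (node u l r) loopless unique (e , nodeOK el er sl sr) =
    step u e (v , u , e) survive
    where
    survive : (a b : Fin n) → Edge E a b → FugitiveWins X (removeEdge E a b) u
    survive a b eab with unique-children {u} {l} {r} unique
    ... | unique-l , unique-r , disjoint
      with endpoint-≢ (loopless⇒≢ loopless eab) u
    ... | c , c∈ab , c≢u with ∉-one-branch disjoint c≢u
    ... | inj₁ c∉ul = planted-wins l (removeEdge-loopless {E} a b loopless) unique-l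
                        (planted-removeEdge l c∈ab c∉ul (el , sl))
    ... | inj₂ c∉ur = planted-wins r (removeEdge-loopless {E} a b loopless) unique-r
                        (planted-removeEdge r c∈ab c∉ur (er , sr))

lemma11 : {n : ℕ} (G : Graph n) → IsSimpleGraph G →
    (X : Subset n) (s : Fin n) →
    Σ (BTree n) (λ t → IsBinaryEscapeTree G X t × (root t ≡ s ⊎ Edge G s (root t))) →
    FugitiveWins X G s
lemma11 G (_ , loopless) X s (t , (shape , unique) , inj₂ e) =
  planted-wins t loopless unique (e , shape)
lemma11 G _ X s (leaf .s , (leafOK s∈X , _) , inj₁ refl) = atExit s∈X
lemma11 G (_ , loopless) X s (node .s l r , (nodeOK el _ sl _ , unique) , inj₁ refl) =
  planted-wins l loopless (proj₁ (unique-children {l = l} {r} unique)) (el , sl)
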